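{- Every countable graph is majority $3$-choosable: for every countable (simple) graph $G$ and every assignment of lists $L(v)$, each consisting of exactly $3$ colours, to the vertices $v\in V(G)$, there is a majority colouring $\chi$ of $G$ with $\chi(v)\in L(v)$ for every $v\in V(G)$.
   Context: A majority colouring of a graph $G$ is an assignment $\chi$ of colours to the vertices such that for every vertex $v$: if $v$ has finite degree, at most half of the edges incident with $v$ are monochromatic (i.e. join $v$ to a neighbour $u$ with $\chi(u)=\chi(v)$); if $v$ has infinite degree, the set of non-monochromatic edges at $v$ has the same cardinality as the whole neighbourhood of $v$ (for a countable graph: $v$ has infinitely many neighbours $u$ with $\chi(u)\neq\chi(v)$). A graph is majority $\ell$-choosable if for every system of lists $(L(v))_{v\in V(G)}$ with $|L(v)|=\ell$ there is a majority colouring $\chi$ with $\chi(v)\in L(v)$ for all $v$. -}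

module Defs where

open import Data.Nat using (ℕ; _*_; _≤_)
open import Data.Fin using (Fin)
open import Data.List using (List; length)
open import Data.List.Membership.Propositional using (_∈_; _∉_)
open import Data.List.Relation.Unary.All using (All)
open import Data.List.Relation.Unary.Unique.Propositional using (Unique)
open import Data.Product using (Σ; ∃; _×_; proj₁)
open import Function.Definitions using (Injective)
open import Relation.Binary.PropositionalEquality using (_≡_; _≢_)
open import Relation.Nullary using (¬_)
open import Function.Bundles using (_⇔_)

record Graph (V : Set) : Set₁ where
  field
    Adj     : V → V → Set
    sym     : ∀ {u v} → Adj u v → Adj v u
    irrefl  : ∀ {v} → ¬ Adj v v

Countable : Set → Set
Countable V = Σ (V → ℕ) (Injective _≡_ _≡_)

module _ {V : Set} (G : Graph V) where
  open Graph G

  EnumeratesNbhd : V → List V → Set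
  EnumeratesNbhd v ns = Unique ns × (∀ u → (Adj v u ⇔ (u ∈ ns)))

  FiniteDegree : V → Set
  FiniteDegree v = ∃ λ ns → EnumeratesNbhd v ns

  -- Infinite degree: v has infinitely many neighbours u with χ u ≢ χ v,
  --   i.e. no finite list contains all of them.
  IsMajorityColouring : {C : Set} → (V → C) → Set
  IsMajorityColouring χ = ∀ v →
      (∀ ns → EnumeratesNbhd v ns →
         ∀ ms → Unique ms → All (λ u → Adj v u × χ u ≡ χ v) ms →
         2 * length ms ≤ length ns)
    × (¬ FiniteDegree v →
         ∀ (xs : List V) → ∃ λ u → Adj v u × χ u ≢ χ v × u ∉ xs)

ListAssignment : (V C : Set) → ℕ → Set
ListAssignment V C ℓ = V → Σ (Fin ℓ → C) (Injective _≡_ _≡_)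

FromLists : {V C : Set} {ℓ : ℕ} → ListAssignment V C ℓ → (V → C) → Set
FromLists {ℓ = ℓ} L χ = ∀ v → ∃ λ (i : Fin ℓ) → proj₁ (L v) i ≡ χ v

MajorityChoosable : {V : Set} → Graph V → ℕ → Set₁
MajorityChoosable {V} G ℓ = ∀ (C : Set) (L : ListAssignment V C ℓ) →
  ∃ λ (χ : V → C) → IsMajorityColouring G χ × FromLists L χ

-- Countability and excluded middle let us enumerate the vertices and decide everything.
-- Along a diagonal schedule, every vertex w of infinite degree is given infinitely many
-- children among its neighbours, each vertex being the child of at most one w.  A vertex
-- always takes one of the two colours of its list that avoid the colour of its parent; a
-- vertex of infinite degree has a fixed such colour, so it differs from all its children.
-- A vertex x of finite degree still chooses between its two colours: on a finite set of such
-- vertices, switching any x that agrees with more of its neighbours than it disagrees with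
-- strictly decreases the number of monochromatic edges meeting the set (edges leaving it
-- counted twice), so a locally optimal choice exists, and local optimality gives the majority
-- condition at x.  Weak König's lemma glues these finite choices into a global one, as the
-- condition at x only depends on the choices at x and its neighbours.

module Submission where

open import Defs
open import Axiom.ExcludedMiddle using (ExcludedMiddle)
open import Level using (0ℓ)
open import Algebra.Properties.CommutativeSemigroup using (interchange)
open import Data.Bool using (Bool; true; false; not; if_then_else_)
open import Data.Fin using (Fin)
open import Data.Fin.Patterns using (0F; 1F; 2F)
open import Data.Maybe using (Maybe; just; nothing; fromMaybe)
open import Data.Maybe.Properties using (just-injective)
open import Data.List using (List; []; _∷_; [_]; length; map; filter)
open import Data.List.Membership.Propositional using (_∈_; _∉_; find)
open import Data.List.Membership.Propositional.Properties using (∈-filter⁺; ∈-filter⁻; ∈-map⁺)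
open import Data.List.Membership.Propositional.Properties.WithK using (unique∧set⇒bag)
open import Data.List.Relation.Binary.BagAndSetEquality using (∼bag⇒↭)
open import Data.List.Relation.Binary.Permutation.Propositional using (_↭_)
import Data.List.Relation.Binary.Permutation.Propositional.Properties as ↭
open ↭ using (↭-length)
open import Data.List.Relation.Unary.All as All using (All; all?)
open import Data.List.Relation.Unary.All.Properties using (¬All⇒Any¬)
open import Data.List.Relation.Unary.Any using (here; there)
open import Data.List.Relation.Unary.AllPairs using ([]; _∷_)
open import Data.List.Relation.Unary.Unique.Propositional using (Unique)
import Data.List.Relation.Unary.Unique.Propositional.Properties as Unique
open import Data.Nat using (ℕ; zero; suc; _+_; _*_; _⊔_; _≤_; _<_; _≤?_; _<?_; z≤n; s≤s) renaming (_≟_ to _≟ℕ_)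
open import Data.Nat.Induction using (<-wellFounded)
open import Data.Nat.ListAction using (sum)
open import Data.Nat.ListAction.Properties using (sum-↭)
open import Data.Nat.Properties hiding (_≟_)
open import Data.List.Extrema ≤-totalOrder using (max; xs≤max)
open import Data.Product using (Σ; ∃; _×_; _,_; proj₁; proj₂)
open import Data.Sum using (inj₁; inj₂)
open import Function using (_∘_)
open import Function.Bundles using (_⇔_; mk⇔; Equivalence)
open import Function.Definitions using (Injective)
import Function.Properties.Equivalence as ⇔
open import Induction.WellFounded using (Acc; acc)
open import Relation.Binary.Definitions using (DecidableEquality; tri<; tri≈; tri>)
open import Relation.Binary.PropositionalEquality using (_≡_; _≢_; refl; sym; trans; cong; cong₂; subst; module ≡-Reasoning)
open import Relation.Nullary using (Dec; yes; no; ¬_; does; contradiction)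
open import Relation.Nullary.Decidable using (¬?; map′)
open import Relation.Unary using (Pred; Decidable)

𝟙 : {P : Set} → Dec P → ℕ
𝟙 (yes _) = 1
𝟙 (no _)  = 0

𝟙-cong : ∀ {P Q : Set} → (P ⇔ Q) → (p : Dec P) (q : Dec Q) → 𝟙 p ≡ 𝟙 q
𝟙-cong P⇔Q (yes _) (yes _) = refl
𝟙-cong P⇔Q (no _)  (no _)  = refl
𝟙-cong P⇔Q (yes p) (no ¬q) = contradiction (Equivalence.to P⇔Q p) ¬q
𝟙-cong P⇔Q (no ¬p) (yes q) = contradiction (Equivalence.from P⇔Q q) ¬p

𝟙-yes : ∀ {P : Set} (p : Dec P) → P → 𝟙 p ≡ 1
𝟙-yes (yes _) _  = refl
𝟙-yes (no ¬p) p = contradiction p ¬p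

𝟙*≤ : ∀ {P : Set} (p : Dec P) {n : ℕ} → 𝟙 p * n ≤ n
𝟙*≤ (yes _) = ≤-reflexive (*-identityˡ _)
𝟙*≤ (no _)  = z≤n

𝟙-unless : ∀ {P : Set} (p : Dec P) {m n : ℕ} → (¬ P → m ≡ n) → 𝟙 (¬? p) * m ≡ 𝟙 (¬? p) * n
𝟙-unless (yes _)  _   = refl
𝟙-unless (no ¬p) m≡n = cong (1 *_) (m≡n ¬p)

∑ : {A : Set} → List A → (A → ℕ) → ℕ
∑ xs f = sum (map f xs)

infix 6.5 ∑
syntax ∑ xs (λ x → t) = ∑[ x ∈ xs ] t

module _ {A : Set} where

  ∑-cong : ∀ xs {f g : A → ℕ} → (∀ {x} → x ∈ xs → f x ≡ g x) → ∑ xs f ≡ ∑ xs g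
  ∑-cong []       f≡g = refl
  ∑-cong (x ∷ xs) f≡g = cong₂ _+_ (f≡g (here refl)) (∑-cong xs (f≡g ∘ there))

  ∑-+ : ∀ xs (f g : A → ℕ) → ∑[ x ∈ xs ] (f x + g x) ≡ ∑ xs f + ∑ xs g
  ∑-+ []       f g = refl
  ∑-+ (x ∷ xs) f g = trans (cong (f x + g x +_) (∑-+ xs f g))
                           (interchange +-commutativeSemigroup (f x) (g x) _ _)

  ∑-mono : ∀ xs {f g : A → ℕ} → (∀ x → f x ≤ g x) → ∑ xs f ≤ ∑ xs g
  ∑-mono []       f≤g = z≤n
  ∑-mono (x ∷ xs) f≤g = +-mono-≤ (f≤g x) (∑-mono xs f≤g)

  ∑-*ˡ : ∀ n xs (f : A → ℕ) → ∑[ x ∈ xs ] n * f x ≡ n * ∑ xs f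
  ∑-*ˡ n []       f = sym (*-zeroʳ n)
  ∑-*ˡ n (x ∷ xs) f = trans (cong (n * f x +_) (∑-*ˡ n xs f)) (sym (*-distribˡ-+ n (f x) _))

  ∑-one : ∀ (xs : List A) → ∑[ x ∈ xs ] 1 ≡ length xs
  ∑-one []       = refl
  ∑-one (x ∷ xs) = cong suc (∑-one xs)

  ∑-↭ : ∀ {xs ys} (f : A → ℕ) → xs ↭ ys → ∑ xs f ≡ ∑ ys f
  ∑-↭ f = sum-↭ ∘ ↭.map⁺ f

  ∑-filter : ∀ {P : Pred A _} (P? : Decidable P) xs (f : A → ℕ) →
             ∑ (filter P? xs) f ≡ ∑[ x ∈ xs ] 𝟙 (P? x) * f x
  ∑-filter P? []       f = refl
  ∑-filter P? (x ∷ xs) f with P? x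
  ... | yes _ = cong₂ _+_ (sym (+-identityʳ (f x))) (∑-filter P? xs f)
  ... | no  _ = ∑-filter P? xs f

  ∑-split : ∀ {P : Pred A _} (P? : Decidable P) xs (f : A → ℕ) →
            ∑ xs f ≡ ∑[ x ∈ xs ] 𝟙 (P? x) * f x + ∑[ x ∈ xs ] 𝟙 (¬? (P? x)) * f x
  ∑-split P? xs f = trans (∑-cong xs λ {x} _ → split (P? x)) (∑-+ xs _ _)
    where
    split : ∀ {P : Set} (d : Dec P) {n : ℕ} → n ≡ 𝟙 d * n + 𝟙 (¬? d) * n
    split (yes _) {n} = sym (trans (+-identityʳ _) (+-identityʳ n))
    split (no _)      = sym (+-identityʳ _)

  ∑-𝟙-disjoint : ∀ {P Q : Pred A _} (P? : Decidable P) (Q? : Decidable Q) → (∀ {x} → P x → ¬ Q x) →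
                 ∀ xs → ∑[ x ∈ xs ] 𝟙 (P? x) + ∑[ x ∈ xs ] 𝟙 (Q? x) ≤ length xs
  ∑-𝟙-disjoint {P} {Q} P? Q? disjoint xs = begin
    ∑[ x ∈ xs ] 𝟙 (P? x) + ∑[ x ∈ xs ] 𝟙 (Q? x)  ≡⟨ ∑-+ xs _ _ ⟨
    ∑[ x ∈ xs ] (𝟙 (P? x) + 𝟙 (Q? x))            ≤⟨ ∑-mono xs (λ x → at-most-one (P? x) (Q? x)) ⟩
    ∑[ x ∈ xs ] 1                                 ≡⟨ ∑-one xs ⟩
    length xs                                     ∎
    where
    open ≤-Reasoning
    at-most-one : ∀ {x} (p : Dec (P x)) (q : Dec (Q x)) → 𝟙 p + 𝟙 q ≤ 1
    at-most-one (yes p) (yes q) = contradiction q (disjoint p)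
    at-most-one (yes _) (no _)  = ≤-refl
    at-most-one (no _)  (yes _) = ≤-refl
    at-most-one (no _)  (no _)  = z≤n

  unique-↭ : ∀ {xs ys : List A} → Unique xs → Unique ys → (∀ {z} → z ∈ xs ⇔ z ∈ ys) → xs ↭ ys
  unique-↭ xs! ys! xs≈ys = ∼bag⇒↭ (unique∧set⇒bag xs! ys! xs≈ys)

module _ {A : Set} (_≟_ : DecidableEquality A) where

  open import Data.List.Membership.DecPropositional _≟_ using (_∈?_)

  ∑-∈-comm : ∀ {xs ys} → Unique xs → Unique ys → (f : A → ℕ) →
             ∑[ x ∈ xs ] 𝟙 (x ∈? ys) * f x ≡ ∑[ y ∈ ys ] 𝟙 (y ∈? xs) * f y
  ∑-∈-comm {xs} {ys} xs! ys! f = begin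
    ∑[ x ∈ xs ] 𝟙 (x ∈? ys) * f x  ≡⟨ ∑-filter (_∈? ys) xs f ⟨
    ∑ (filter (_∈? ys) xs) f        ≡⟨ ∑-↭ f (unique-↭ (Unique.filter⁺ _ xs!) (Unique.filter⁺ _ ys!) both) ⟩
    ∑ (filter (_∈? xs) ys) f        ≡⟨ ∑-filter (_∈? xs) ys f ⟩
    ∑[ y ∈ ys ] 𝟙 (y ∈? xs) * f y  ∎
    where
    open ≡-Reasoning
    swap : ∀ {z} {as bs : List A} → z ∈ filter (_∈? bs) as → z ∈ filter (_∈? as) bs
    swap {bs = bs} z∈ = let z∈as , z∈bs = ∈-filter⁻ (_∈? bs) z∈ in ∈-filter⁺ _ z∈bs z∈as
    both : ∀ {z} → z ∈ filter (_∈? ys) xs ⇔ z ∈ filter (_∈? xs) ys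
    both = mk⇔ (swap {as = xs} {bs = ys}) (swap {as = ys} {bs = xs})

  length≤∑𝟙 : ∀ {P : Pred A _} (P? : Decidable P) {ms xs} → Unique ms → Unique xs →
              (∀ {x} → x ∈ ms → x ∈ xs × P x) → length ms ≤ ∑[ x ∈ xs ] 𝟙 (P? x)
  length≤∑𝟙 {P} P? {ms} {xs} ms! xs! ms⊆ = begin
    length ms                               ≡⟨ ∑-one ms ⟨
    ∑[ x ∈ ms ] 1                           ≡⟨ ∑-cong ms (λ x∈ms → sym (both (x∈ms , ms⊆ x∈ms))) ⟩
    ∑[ x ∈ ms ] 𝟙 (x ∈? xs) * 𝟙 (P? x)      ≡⟨ ∑-∈-comm xs! ms! (𝟙 ∘ P?) ⟨
    ∑[ x ∈ xs ] 𝟙 (x ∈? ms) * 𝟙 (P? x)      ≤⟨ ∑-mono xs (λ x → 𝟙*≤ (x ∈? ms)) ⟩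
    ∑[ x ∈ xs ] 𝟙 (P? x)                    ∎
    where
    open ≤-Reasoning
    both : ∀ {x} → x ∈ ms × x ∈ xs × P x → 𝟙 (x ∈? xs) * 𝟙 (P? x) ≡ 1
    both {x} (_ , x∈xs , Px) = cong₂ _*_ (𝟙-yes (x ∈? xs) x∈xs) (𝟙-yes (P? x) Px)

  ∑-pick : ∀ {xs} → Unique xs → ∀ y (f : A → ℕ) → ∑[ x ∈ xs ] 𝟙 (x ≟ y) * f x ≡ 𝟙 (y ∈? xs) * f y
  ∑-pick {xs} xs! y f = begin
    ∑[ x ∈ xs ] 𝟙 (x ≟ y) * f x       ≡⟨ ∑-cong xs (λ {x} _ → cong (_* f x) (≟-as-∈? x)) ⟩
    ∑[ x ∈ xs ] 𝟙 (x ∈? [ y ]) * f x  ≡⟨ ∑-∈-comm xs! (All.[] ∷ []) f ⟩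
    𝟙 (y ∈? xs) * f y + 0             ≡⟨ +-identityʳ _ ⟩
    𝟙 (y ∈? xs) * f y                 ∎
    where
    open ≡-Reasoning
    ≟-as-∈? : ∀ x → 𝟙 (x ≟ y) ≡ 𝟙 (x ∈? [ y ])
    ≟-as-∈? x with x ≟ y | x ∈? [ y ]
    ... | yes _   | yes _          = refl
    ... | no _    | no _           = refl
    ... | yes x≡y | no x∉[y]       = contradiction (here x≡y) x∉[y]
    ... | no x≢y  | yes (here x≡y) = contradiction x≡y x≢y

module LocalOptimum
  {V C : Set} (_≟_ : DecidableEquality V) (_≟ᶜ_ : DecidableEquality C)
  (N : V → List V) (hue : V → Bool → C) {S : List V} (S! : Unique S)
  (N! : ∀ {v} → v ∈ S → Unique (N v))
  (N-irrefl : ∀ {v} → v ∈ S → v ∉ N v)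
  (N-sym : ∀ {u v} → u ∈ S → v ∈ S → u ∈ N v → v ∈ N u)
  where

  open import Data.List.Membership.DecPropositional _≟_ using (_∈?_)

  colour : (V → Bool) → V → C
  colour β v = hue v (β v)

  count : (V → Bool) → V → C → ℕ
  count β x c = ∑[ u ∈ N x ] 𝟙 (colour β u ≟ᶜ c)

  LocallyOptimal : (V → Bool) → V → Set
  LocallyOptimal β x = count β x (colour β x) ≤ count β x (hue x (not (β x)))

  optimal? : ∀ β x → Dec (LocallyOptimal β x)
  optimal? β x = count β x (colour β x) ≤? count β x (hue x (not (β x)))

  toggle : V → (V → Bool) → V → Bool
  toggle x β v = if does (v ≟ x) then not (β v) else β v

  toggle-self : ∀ x β → toggle x β x ≡ not (β x)
  toggle-self x β with x ≟ x
  ... | yes _   = refl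
  ... | no x≢x = contradiction refl x≢x

  toggle-other : ∀ {x v} β → v ≢ x → toggle x β v ≡ β v
  toggle-other {x} {v} β v≢x with v ≟ x
  ... | yes v≡x = contradiction v≡x v≢x
  ... | no _    = refl

  count-toggle : ∀ {x} β c → x ∈ S → count (toggle x β) x c ≡ count β x c
  count-toggle {x} β c x∈S = ∑-cong (N x) λ {u} u∈N →
    cong (λ b → 𝟙 (hue u b ≟ᶜ c)) (toggle-other β λ { refl → N-irrefl x∈S u∈N })

  same : (V → Bool) → V → V → ℕ
  same β v u = 𝟙 (colour β u ≟ᶜ colour β v)

  same-sym : ∀ β v u → same β v u ≡ same β u v
  same-sym β v u = 𝟙-cong (mk⇔ sym sym) (colour β u ≟ᶜ colour β v) (colour β v ≟ᶜ colour β u)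

  same-toggle : ∀ {x v u} β → v ≢ x → u ≢ x → same (toggle x β) v u ≡ same β v u
  same-toggle {v = v} {u} β v≢x u≢x =
    cong₂ (λ a b → 𝟙 (hue u a ≟ᶜ hue v b)) (toggle-other β u≢x) (toggle-other β v≢x)

  weight : V → ℕ
  weight u = if does (u ∈? S) then 1 else 2

  weight-inside : ∀ {u} → u ∈ S → weight u ≡ 1
  weight-inside {u} u∈S with u ∈? S
  ... | yes _    = refl
  ... | no u∉S = contradiction u∈S u∉S

  weight-complement : ∀ u → weight u + 𝟙 (u ∈? S) ≡ 2
  weight-complement u with u ∈? S
  ... | yes _ = refl
  ... | no _  = refl

  -- Twice the number of monochromatic edges meeting S: an edge inside S is seen from both ends.
  potential : (V → Bool) → ℕ
  potential β = ∑[ v ∈ S ] (∑[ u ∈ N v ] weight u * same β v u)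

  potential-without : V → (V → Bool) → ℕ
  potential-without x β = ∑[ v ∈ S ] 𝟙 (¬? (v ≟ x)) * (∑[ u ∈ N v ] 𝟙 (¬? (u ≟ x)) * (weight u * same β v u))

  module _ {x : V} (β : V → Bool) (x∈S : x ∈ S) where

    private
      F G : V → ℕ
      F v = ∑[ u ∈ N v ] weight u * same β v u
      G v = ∑[ u ∈ N v ] 𝟙 (¬? (u ≟ x)) * (weight u * same β v u)

    split-at-x : ∀ {v} → v ∈ S → F v ≡ 𝟙 (x ∈? N v) * same β v x + G v
    split-at-x {v} v∈S = begin
      F v                                                      ≡⟨ ∑-split (_≟ x) (N v) _ ⟩
      ∑[ u ∈ N v ] 𝟙 (u ≟ x) * (weight u * same β v u) + G v  ≡⟨ cong (_+ G v) (∑-pick _≟_ (N! v∈S) x _) ⟩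
      𝟙 (x ∈? N v) * (weight x * same β v x) + G v            ≡⟨ cong (λ w → 𝟙 (x ∈? N v) * (w * same β v x) + G v) (weight-inside x∈S) ⟩
      𝟙 (x ∈? N v) * (1 * same β v x) + G v                   ≡⟨ cong (λ s → 𝟙 (x ∈? N v) * s + G v) (*-identityˡ _) ⟩
      𝟙 (x ∈? N v) * same β v x + G v                         ∎
      where open ≡-Reasoning

    edges-into-x : ∑[ v ∈ S ] 𝟙 (¬? (v ≟ x)) * (𝟙 (x ∈? N v) * same β v x)
                 ≡ ∑[ u ∈ N x ] 𝟙 (u ∈? S) * same β x u
    edges-into-x = trans (∑-cong S reverse) (∑-∈-comm _≟_ S! (N! x∈S) (same β x))
      where
      reverse : ∀ {v} → v ∈ S → 𝟙 (¬? (v ≟ x)) * (𝟙 (x ∈? N v) * same β v x) ≡ 𝟙 (v ∈? N x) * same β x v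
      reverse {v} v∈S with v ≟ x
      ... | yes refl = cong (_* same β x x) (𝟙-cong (mk⇔ (λ ()) (N-irrefl x∈S)) (no λ ()) (x ∈? N x))
      ... | no _     = trans (+-identityʳ _)
        (cong₂ _*_ (𝟙-cong (mk⇔ (N-sym x∈S v∈S) (N-sym v∈S x∈S)) (x ∈? N v) (v ∈? N x)) (same-sym β v x))

    edges-at-x : F x + ∑[ u ∈ N x ] 𝟙 (u ∈? S) * same β x u ≡ 2 * count β x (colour β x)
    edges-at-x = begin
      F x + ∑[ u ∈ N x ] 𝟙 (u ∈? S) * same β x u                   ≡⟨ ∑-+ (N x) _ _ ⟨
      ∑[ u ∈ N x ] (weight u * same β x u + 𝟙 (u ∈? S) * same β x u) ≡⟨ ∑-cong (N x) (λ {u} _ → twice u) ⟩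
      ∑[ u ∈ N x ] 2 * same β x u                                   ≡⟨ ∑-*ˡ 2 (N x) _ ⟩
      2 * count β x (colour β x)                                  ∎
      where
      open ≡-Reasoning
      twice : ∀ u → weight u * same β x u + 𝟙 (u ∈? S) * same β x u ≡ 2 * same β x u
      twice u = trans (sym (*-distribʳ-+ (same β x u) (weight u) _)) (cong (_* same β x u) (weight-complement u))

    potential-at : potential β ≡ 2 * count β x (colour β x) + potential-without x β
    potential-at = begin
      potential β
        ≡⟨ ∑-split (_≟ x) S F ⟩
      ∑[ v ∈ S ] 𝟙 (v ≟ x) * F v + ∑[ v ∈ S ] 𝟙 (¬? (v ≟ x)) * F v
        ≡⟨ cong₂ _+_ (∑-pick _≟_ S! x F) (∑-cong S λ {v} v∈S → cong (𝟙 (¬? (v ≟ x)) *_) (split-at-x v∈S)) ⟩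
      𝟙 (x ∈? S) * F x + ∑[ v ∈ S ] 𝟙 (¬? (v ≟ x)) * (𝟙 (x ∈? N v) * same β v x + G v)
        ≡⟨ cong₂ _+_ (trans (cong (_* F x) (𝟙-yes (x ∈? S) x∈S)) (*-identityˡ _))
                     (trans (∑-cong S λ {v} _ → *-distribˡ-+ (𝟙 (¬? (v ≟ x))) _ _) (∑-+ S _ _)) ⟩
      F x + (∑[ v ∈ S ] 𝟙 (¬? (v ≟ x)) * (𝟙 (x ∈? N v) * same β v x) + potential-without x β)
        ≡⟨ cong (λ e → F x + (e + potential-without x β)) edges-into-x ⟩
      F x + (∑[ u ∈ N x ] 𝟙 (u ∈? S) * same β x u + potential-without x β)
        ≡⟨ +-assoc (F x) _ _ ⟨
      F x + ∑[ u ∈ N x ] 𝟙 (u ∈? S) * same β x u + potential-without x β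
        ≡⟨ cong (_+ potential-without x β) edges-at-x ⟩
      2 * count β x (colour β x) + potential-without x β
        ∎
      where open ≡-Reasoning

  potential-without-toggle : ∀ x β → potential-without x (toggle x β) ≡ potential-without x β
  potential-without-toggle x β = ∑-cong S λ {v} _ → 𝟙-unless (v ≟ x) λ v≢x →
    ∑-cong (N v) λ {u} _ → 𝟙-unless (u ≟ x) λ u≢x → cong (weight u *_) (same-toggle β v≢x u≢x)

  toggle-decreases : ∀ {x} β → x ∈ S → ¬ LocallyOptimal β x → potential (toggle x β) < potential β
  toggle-decreases {x} β x∈S ¬opt = begin-strict
    potential (toggle x β)                               ≡⟨ potential-at (toggle x β) x∈S ⟩
    2 * count (toggle x β) x (colour (toggle x β) x) + potential-without x (toggle x β)
      ≡⟨ cong₂ (λ c a → 2 * count (toggle x β) x (hue x c) + a) (toggle-self x β) (potential-without-toggle x β) ⟩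
    2 * count (toggle x β) x (hue x (not (β x))) + potential-without x β
      ≡⟨ cong (λ n → 2 * n + potential-without x β) (count-toggle β _ x∈S) ⟩
    2 * count β x (hue x (not (β x))) + potential-without x β     <⟨ +-monoˡ-< (potential-without x β) (*-monoʳ-< 2 (≰⇒> ¬opt)) ⟩
    2 * count β x (colour β x) + potential-without x β            ≡⟨ potential-at β x∈S ⟨
    potential β                                          ∎
    where open ≤-Reasoning

  locally-optimal-exists : ∃ λ β → All (LocallyOptimal β) S
  locally-optimal-exists = descend (λ _ → true) (<-wellFounded _)
    where
    descend : ∀ β → Acc _<_ (potential β) → ∃ λ β → All (LocallyOptimal β) S
    descend β (acc smaller) with all? (optimal? β) S
    ... | yes optimal = β , optimal
    ... | no ¬optimal =
      let x , x∈S , ¬opt = find (¬All⇒Any¬ (optimal? β) S ¬optimal)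
      in descend (toggle x β) (smaller (toggle-decreases β x∈S ¬opt))

module Classical (lem : ExcludedMiddle 0ℓ) where

  ¬∀⇒∃¬ : ∀ {A : Set} {Q : A → Set} → ¬ (∀ x → Q x) → ∃ λ x → ¬ Q x
  ¬∀⇒∃¬ {Q = Q} ¬∀Q with lem {∃ λ x → ¬ Q x}
  ... | yes witness = witness
  ... | no none = contradiction holds ¬∀Q
    where
    holds : ∀ x → Q x
    holds x with lem {Q x}
    ... | yes q = q
    ... | no ¬q = contradiction (x , ¬q) none

module WeakKőnig
  (lem : ExcludedMiddle 0ℓ) (P : ℕ → (ℕ → Bool) → Set)
  (P-antitone : ∀ {m m′ b} → m ≤ m′ → P m′ b → P m b)
  (P-inhabited : ∀ m → ∃ (P m))
  where

  open Classical lem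

  _≈[<_]_ : (ℕ → Bool) → ℕ → (ℕ → Bool) → Set
  b ≈[< n ] b′ = ∀ i → i < n → b i ≡ b′ i

  Approximable : ℕ → (ℕ → Bool) → Set
  Approximable n b = ∀ m → ∃ λ b′ → P m b′ × b′ ≈[< n ] b

  set : ℕ → Bool → (ℕ → Bool) → ℕ → Bool
  set n c b i with i ≟ℕ n
  ... | yes _ = c
  ... | no _  = b i

  set-below : ∀ {n c b i} → i < n → set n c b i ≡ b i
  set-below {n} {i = i} i<n with i ≟ℕ n
  ... | yes refl = contradiction i<n (<-irrefl refl)
  ... | no _     = refl

  set-agrees : ∀ {n c b b′} → b′ ≈[< n ] b → b′ n ≡ c → b′ ≈[< suc n ] set n c b
  set-agrees {n} b′≈b b′n≡c i i<1+n with i ≟ℕ n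
  ... | yes refl = b′n≡c
  ... | no i≢n   = b′≈b i (≤∧≢⇒< (≤-pred i<1+n) i≢n)

  extend : ∀ {n b} → Approximable n b → ∃ λ c → Approximable (suc n) (set n c b)
  extend {n} {b} approx with lem {Approximable (suc n) (set n true b)}
  ... | yes approx-true = true , approx-true
  ... | no ¬approx-true = false , approx-false
    where
    approx-false : Approximable (suc n) (set n false b)
    approx-false m with ¬∀⇒∃¬ ¬approx-true
    ... | m₁ , none with approx (m ⊔ m₁)
    ... | b′ , Pb′ , b′≈b with b′ n in b′n
    ... | true  = contradiction (b′ , P-antitone (m≤n⊔m m m₁) Pb′ , set-agrees b′≈b b′n) none
    ... | false = b′ , P-antitone (m≤m⊔n m m₁) Pb′ , set-agrees b′≈b b′n

  approximation : ∀ n → Σ (ℕ → Bool) (Approximable n)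
  approximation zero    = (λ _ → true) , λ m → let b , Pb = P-inhabited m in b , Pb , λ _ ()
  approximation (suc n) = let b , approx = approximation n
                              c , approx′ = extend approx
                          in set n c b , approx′

  limit : ℕ → Bool
  limit i = proj₁ (approximation (suc i)) i

  approximation-stable : ∀ {n i} → i < n → proj₁ (approximation n) i ≡ limit i
  approximation-stable {suc n} {i} i<1+n with m<1+n⇒m<n∨m≡n i<1+n
  ... | inj₂ refl = refl
  ... | inj₁ i<n  = trans (set-below i<n) (approximation-stable i<n)

  limit-approximable : ∀ n → Approximable n limit
  limit-approximable n m =
    let b′ , Pb′ , b′≈ = proj₂ (approximation n) m
    in b′ , Pb′ , λ i i<n → trans (b′≈ i i<n) (approximation-stable i<n)

module Indexing (lem : ExcludedMiddle 0ℓ) {V : Set} (e : V → ℕ) (e-inj : Injective _≡_ _≡_ e) where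

  _≟_ : DecidableEquality V
  u ≟ v = map′ e-inj (cong e) (e u ≟ℕ e v)

  enumerate-below : (P : V → Set) → ∀ n → ∃ λ xs → Unique xs × (∀ {u} → (P u × e u < n) ⇔ u ∈ xs)
  enumerate-below P zero = [] , [] , mk⇔ (λ ()) (λ ())
  enumerate-below P (suc n) with enumerate-below P n | lem {∃ λ u → P u × e u ≡ n}
  ... | xs , xs! , xs≈ | no none = xs , xs! , mk⇔ to (weaken ∘ Equivalence.from xs≈)
    where
    to : ∀ {u} → P u × e u < suc n → u ∈ xs
    to (Pu , eu<1+n) with m<1+n⇒m<n∨m≡n eu<1+n
    ... | inj₁ eu<n = Equivalence.to xs≈ (Pu , eu<n)
    ... | inj₂ eu≡n = contradiction (_ , Pu , eu≡n) none
    weaken : ∀ {u} → P u × e u < n → P u × e u < suc n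
    weaken (Pu , eu<n) = Pu , m<n⇒m<1+n eu<n
  ... | xs , xs! , xs≈ | yes (w , Pw , ew≡n) = w ∷ xs , All.tabulate fresh ∷ xs! , mk⇔ to from
    where
    fresh : ∀ {u} → u ∈ xs → w ≢ u
    fresh u∈xs refl = <-irrefl ew≡n (proj₂ (Equivalence.from xs≈ u∈xs))
    to : ∀ {u} → P u × e u < suc n → u ∈ w ∷ xs
    to (Pu , eu<1+n) with m<1+n⇒m<n∨m≡n eu<1+n
    ... | inj₁ eu<n = there (Equivalence.to xs≈ (Pu , eu<n))
    ... | inj₂ eu≡n = here (e-inj (trans eu≡n (sym ew≡n)))
    from : ∀ {u} → u ∈ w ∷ xs → P u × e u < suc n
    from (here refl)    = Pw , s≤s (≤-reflexive ew≡n)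
    from (there u∈xs) = let Pu , eu<n = Equivalence.from xs≈ u∈xs in Pu , m<n⇒m<1+n eu<n

  bound : ∀ xs → ∃ λ n → ∀ {u} → u ∈ xs → e u < n
  bound xs = suc (max 0 (map e xs)) , λ u∈xs → s≤s (All.lookup (xs≤max 0 (map e xs)) (∈-map⁺ e u∈xs))

  unbounded-escapes : ∀ {P : V → Set} → (∀ B → ∃ λ u → P u × B < e u) → ∀ xs → ∃ λ u → P u × u ∉ xs
  unbounded-escapes unbounded xs =
    let n , below = bound xs
        u , Pu , n<eu = unbounded n
    in u , Pu , λ u∈xs → <-asym n<eu (below u∈xs)

  factor : ∀ {A : Set} → A → (β : V → A) → ∃ λ (b : ℕ → A) → ∀ u → b (e u) ≡ β u
  factor {A} default β = b , b∘e
    where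
    b : ℕ → A
    b i with lem {∃ λ u → e u ≡ i}
    ... | yes (u , _) = β u
    ... | no _        = default
    b∘e : ∀ u → b (e u) ≡ β u
    b∘e u with lem {∃ λ v → e v ≡ e u}
    ... | yes (v , ev≡eu) = cong β (e-inj ev≡eu)
    ... | no none         = contradiction (u , refl) none

advance : ℕ × ℕ → ℕ × ℕ
advance (i , k) with i <? k
... | yes _ = suc i , k
... | no _  = 0 , suc k

schedule : ℕ → ℕ × ℕ
schedule zero    = 0 , 0
schedule (suc s) = advance (schedule s)

schedule-visits : ∀ k i → i ≤ k → ∃ λ s → schedule s ≡ (i , k)
schedule-visits zero    zero    _ = 0 , refl
schedule-visits (suc k) zero    _ =
  let s , at = schedule-visits k k ≤-refl in suc s , trans (cong advance at) new-round
  where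
  new-round : advance (k , k) ≡ (0 , suc k)
  new-round with k <? k
  ... | yes k<k = contradiction k<k (<-irrefl refl)
  ... | no _    = refl
schedule-visits k (suc i) i<k =
  let s , at = schedule-visits k i (<⇒≤ i<k) in suc s , trans (cong advance at) next
  where
  next : advance (i , k) ≡ (suc i , k)
  next with i <? k
  ... | yes _   = refl
  ... | no i≮k = contradiction i<k i≮k

schedule-round : ∀ s → proj₂ (schedule s) ≤ s
schedule-round zero    = z≤n
schedule-round (suc s) = round-advance (schedule s) (schedule-round s)
  where
  round-advance : ∀ p → proj₂ p ≤ s → proj₂ (advance p) ≤ suc s
  round-advance (i , k) k≤s with i <? k
  ... | yes _ = m≤n⇒m≤1+n k≤s
  ... | no _  = s≤s k≤s

target : ℕ → ℕ
target s = proj₁ (schedule s)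

target-recurs : ∀ i B → ∃ λ s → B ≤ s × target s ≡ i
target-recurs i B =
  let s , at = schedule-visits (i ⊔ B) i (m≤m⊔n i B)
  in s , ≤-trans (m≤n⊔m i B) (subst (λ p → proj₂ p ≤ s) at (schedule-round s)) , cong proj₁ at

module ChildSelection (lem : ExcludedMiddle 0ℓ) {V : Set} (e : V → ℕ) (e-inj : Injective _≡_ _≡_ e)
                      (R : V → V → Set) where

  -- The bound M + i puts the child above both the threshold M and the index i of its parent.
  Candidate : ℕ → ℕ → V × V → Set
  Candidate M i (w , u) = e w ≡ i × R w u × M + i < e u

  pick-at : ℕ → ℕ → Maybe (V × V)
  pick-at M i with lem {∃ (Candidate M i)}
  ... | yes (p , _) = just p
  ... | no _        = nothing

  pick-at-candidate : ∀ {M i p} → pick-at M i ≡ just p → Candidate M i p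
  pick-at-candidate {M} {i} picked with lem {∃ (Candidate M i)}
  pick-at-candidate refl | yes (_ , candidate) = candidate

  pick-at-just : ∀ {M i} → ∃ (Candidate M i) → ∃ λ p → pick-at M i ≡ just p
  pick-at-just {M} {i} candidate with lem {∃ (Candidate M i)}
  ... | yes (p , _) = p , refl
  ... | no none     = contradiction candidate none

  next-threshold : ℕ → Maybe (V × V) → ℕ
  next-threshold M nothing        = suc M
  next-threshold M (just (_ , u)) = e u

  -- Every pick lies above the threshold and raises it, so no vertex is picked twice.
  threshold : ℕ → ℕ
  threshold zero    = 0
  threshold (suc s) = next-threshold (threshold s) (pick-at (threshold s) (target s))

  pick : ℕ → Maybe (V × V)
  pick s = pick-at (threshold s) (target s)

  pick-above-threshold : ∀ s {w u} → pick s ≡ just (w , u) → threshold s < e u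
  pick-above-threshold s picked = let _ , _ , M+i<eu = pick-at-candidate picked in ≤-<-trans (m≤m+n _ _) M+i<eu

  pick-above-parent : ∀ s {w u} → pick s ≡ just (w , u) → e w < e u
  pick-above-parent s picked =
    let ew≡i , _ , M+i<eu = pick-at-candidate picked in ≤-<-trans (≤-trans (≤-reflexive ew≡i) (m≤n+m _ _)) M+i<eu

  threshold-after-pick : ∀ s {w u} → pick s ≡ just (w , u) → threshold (suc s) ≡ e u
  threshold-after-pick s picked = cong (next-threshold (threshold s)) picked

  pick-targeted : ∀ s {w} → target s ≡ e w → (∃ λ u → R w u × threshold s + e w < e u) →
                  ∃ λ u → pick s ≡ just (w , u)
  pick-targeted s {w} target≡ew (u , Rwu , above) rewrite target≡ew
    with pick-at-just ((w , u) , refl , Rwu , above)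
  ... | (w′ , u′) , picked with e-inj (proj₁ (pick-at-candidate picked))
  ... | refl = u′ , picked

  threshold-increasing : ∀ s → threshold s < threshold (suc s)
  threshold-increasing s with pick s in picked
  ... | nothing      = ≤-refl
  ... | just (w , u) = pick-above-threshold s picked

  threshold-mono : ∀ {s s′} → s ≤ s′ → threshold s ≤ threshold s′
  threshold-mono {s′ = zero}   z≤n = ≤-refl
  threshold-mono {s′ = suc s′} s≤1+s′ with m≤n⇒m<n∨m≡n s≤1+s′
  ... | inj₁ s<1+s′ = ≤-trans (threshold-mono (≤-pred s<1+s′)) (<⇒≤ (threshold-increasing s′))
  ... | inj₂ refl   = ≤-refl

  stage≤threshold : ∀ s → s ≤ threshold s
  stage≤threshold zero    = z≤n
  stage≤threshold (suc s) = ≤-<-trans (stage≤threshold s) (threshold-increasing s)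

  picks-increase : ∀ {s s′ w w′ u u′} → s < s′ → pick s ≡ just (w , u) → pick s′ ≡ just (w′ , u′) → e u < e u′
  picks-increase {s} {s′} {u = u} {u′ = u′} s<s′ picked picked′ = begin-strict
    e u                ≡⟨ threshold-after-pick s picked ⟨
    threshold (suc s)  ≤⟨ threshold-mono s<s′ ⟩
    threshold s′       <⟨ pick-above-threshold s′ picked′ ⟩
    e u′               ∎
    where open ≤-Reasoning

  picked-once : ∀ {s s′ w w′ u} → pick s ≡ just (w , u) → pick s′ ≡ just (w′ , u) → s ≡ s′
  picked-once {s} {s′} picked picked′ with <-cmp s s′
  ... | tri< s<s′ _ _ = contradiction (picks-increase s<s′ picked picked′) (<-irrefl refl)
  ... | tri≈ _ s≡s′ _ = s≡s′
  ... | tri> _ _ s′<s = contradiction (picks-increase s′<s picked′ picked) (<-irrefl refl)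

  parent : V → Maybe V
  parent u with lem {∃ λ s → ∃ λ w → pick s ≡ just (w , u)}
  ... | yes (_ , w , _) = just w
  ... | no _            = nothing

  parent-spec : ∀ {u w} → parent u ≡ just w → R w u × e w < e u
  parent-spec {u} found with lem {∃ λ s → ∃ λ w → pick s ≡ just (w , u)}
  parent-spec refl | yes (s , w , picked) = proj₁ (proj₂ (pick-at-candidate picked)) , pick-above-parent s picked

  parent-of-pick : ∀ s {w u} → pick s ≡ just (w , u) → parent u ≡ just w
  parent-of-pick s {w} {u} picked with lem {∃ λ s → ∃ λ w → pick s ≡ just (w , u)}
  ... | no none = contradiction (s , w , picked) none
  ... | yes (s′ , w′ , picked′) with picked-once {s} {s′} picked picked′
  ... | refl = cong (just ∘ proj₁) (just-injective (trans (sym picked′) picked))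

  children-unbounded : ∀ {w} → (∀ B → ∃ λ u → R w u × B < e u) → ∀ B → ∃ λ u → parent u ≡ just w × B < e u
  children-unbounded {w} unbounded B =
    let s , B≤s , target≡ew = target-recurs (e w) B
        u , picked = pick-targeted s target≡ew (unbounded (threshold s + e w))
    in u , parent-of-pick s picked , ≤-<-trans (≤-trans B≤s (stage≤threshold s)) (pick-above-threshold s picked)

module Recursion {V A : Set} (e : V → ℕ) (parent : V → Maybe V)
                 (parent-below : ∀ {u w} → parent u ≡ just w → e w < e u) (step : V → Maybe A → A) where

  unroll : ℕ → V → A
  unroll zero    u = step u nothing
  unroll (suc k) u = step u (Data.Maybe.map (unroll k) (parent u))

  unroll-stable : ∀ {k k′ u} → e u < k → e u < k′ → unroll k u ≡ unroll k′ u
  unroll-stable {suc k} {suc k′} {u} u<1+k u<1+k′ with parent u in found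
  ... | nothing = refl
  ... | just w  = cong (step u ∘ just)
    (unroll-stable (<-≤-trans (parent-below found) (≤-pred u<1+k)) (<-≤-trans (parent-below found) (≤-pred u<1+k′)))

  recurse : V → A
  recurse u = unroll (suc (e u)) u

  recurse-unfold : ∀ u → recurse u ≡ step u (Data.Maybe.map recurse (parent u))
  recurse-unfold u with parent u in found
  ... | nothing = refl
  ... | just w  = cong (step u ∘ just) (unroll-stable (parent-below found) ≤-refl)

module _ {C : Set} (_≟ᶜ_ : DecidableEquality C) where

  pair-avoiding : (f : Fin 3 → C) → Injective _≡_ _≡_ f → (c : C) →
                  Σ (Bool → Fin 3) λ g → g true ≢ g false × ∀ b → f (g b) ≢ c
  pair-avoiding f f-inj c with f 0F ≟ᶜ c | f 1F ≟ᶜ c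
  ... | yes f0≡c | _        = (λ b → if b then 1F else 2F) , (λ ()) , λ
    { true  f1≡c → contradiction (f-inj (trans f1≡c (sym f0≡c))) λ ()
    ; false f2≡c → contradiction (f-inj (trans f2≡c (sym f0≡c))) λ () }
  ... | no f0≢c  | yes f1≡c = (λ b → if b then 0F else 2F) , (λ ()) , λ
    { true  → f0≢c
    ; false f2≡c → contradiction (f-inj (trans f2≡c (sym f1≡c))) λ () }
  ... | no f0≢c  | no f1≢c  = (λ b → if b then 0F else 1F) , (λ ()) , λ { true → f0≢c ; false → f1≢c }

module MajorityColouring (lem : ExcludedMiddle 0ℓ) {V : Set} (G : Graph V)
                         (e : V → ℕ) (e-inj : Injective _≡_ _≡_ e) {C : Set} (L : ListAssignment V C 3) where

  open Graph G renaming (sym to Adj-sym)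
  open Indexing lem e e-inj

  _≟ᶜ_ : DecidableEquality C
  _ ≟ᶜ _ = lem

  AtMostHalfMonochromatic : (V → C) → V → Set
  AtMostHalfMonochromatic χ v = ∀ ns → EnumeratesNbhd G v ns →
    ∀ ms → Unique ms → All (λ u → Adj v u × χ u ≡ χ v) ms → 2 * length ms ≤ length ns

  at-most-half-local : ∀ {χ χ′ v} → χ v ≡ χ′ v → (∀ {u} → Adj v u → χ u ≡ χ′ u) →
                       AtMostHalfMonochromatic χ v → AtMostHalfMonochromatic χ′ v
  at-most-half-local χv≡ χu≡ half ns en ms ms! mono′ =
    half ns en ms ms! (All.map (λ (a , χ′u≡χ′v) → a , trans (χu≡ a) (trans χ′u≡χ′v (sym χv≡))) mono′)

  enumerations-same-length : ∀ {v ns ns′} → EnumeratesNbhd G v ns → EnumeratesNbhd G v ns′ → length ns ≡ length ns′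
  enumerations-same-length (ns! , ns≈) (ns′! , ns′≈) =
    ↭-length (unique-↭ ns! ns′! λ {u} → ⇔.trans (⇔.sym (ns≈ u)) (ns′≈ u))

  at-most-half : ∀ {χ : V → C} {v ns c} → EnumeratesNbhd G v ns → c ≢ χ v →
                 ∑[ u ∈ ns ] 𝟙 (χ u ≟ᶜ χ v) ≤ ∑[ u ∈ ns ] 𝟙 (χ u ≟ᶜ c) → AtMostHalfMonochromatic χ v
  at-most-half {χ} {v} {ns} {c} enumerates@(ns! , ns≈) c≢χv optimal ns′ enumerates′ ms ms! mono = begin
    2 * length ms     ≤⟨ *-monoʳ-≤ 2 (length≤∑𝟙 _≟_ (λ u → χ u ≟ᶜ χ v) ms! ns! monochromatic) ⟩
    2 * same          ≡⟨ cong (same +_) (+-identityʳ same) ⟩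
    same + same       ≤⟨ +-monoʳ-≤ same optimal ⟩
    same + other      ≤⟨ ∑-𝟙-disjoint (λ u → χ u ≟ᶜ χ v) (λ u → χ u ≟ᶜ c) (λ p q → c≢χv (trans (sym q) p)) ns ⟩
    length ns         ≡⟨ enumerations-same-length enumerates enumerates′ ⟩
    length ns′        ∎
    where
    open ≤-Reasoning
    same other : ℕ
    same  = ∑[ u ∈ ns ] 𝟙 (χ u ≟ᶜ χ v)
    other = ∑[ u ∈ ns ] 𝟙 (χ u ≟ᶜ c)
    monochromatic : ∀ {u} → u ∈ ms → u ∈ ns × χ u ≡ χ v
    monochromatic u∈ms = let a , χu≡χv = All.lookup mono u∈ms in Equivalence.to (ns≈ _) a , χu≡χv

  infinite-degree-unbounded : ∀ {w} → ¬ FiniteDegree G w → ∀ B → ∃ λ u → Adj w u × B < e u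
  infinite-degree-unbounded {w} infinite B with lem {∃ λ u → Adj w u × B < e u} | enumerate-below (Adj w) (suc B)
  ... | yes high | _ = high
  ... | no none  | xs , xs! , xs≈ =
    contradiction (xs , xs! , λ u → mk⇔ (λ a → Equivalence.to xs≈ (a , low a)) (proj₁ ∘ Equivalence.from xs≈)) infinite
    where
    low : ∀ {u} → Adj w u → e u < suc B
    low {u} a = s≤s (≮⇒≥ λ B<eu → none (u , a , B<eu))

  open ChildSelection lem e e-inj (λ w u → ¬ FiniteDegree G w × Adj w u)

  avoid : V → C → Bool → C
  avoid u c = proj₁ (L u) ∘ proj₁ (pair-avoiding _≟ᶜ_ (proj₁ (L u)) (proj₂ (L u)) c)

  open Recursion e parent (proj₂ ∘ parent-spec) (λ u c → avoid u (fromMaybe (proj₁ (L u) 0F) c) true)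
    renaming (recurse to principal; recurse-unfold to principal-unfold)

  forbidden : V → C
  forbidden u = fromMaybe (proj₁ (L u) 0F) (Data.Maybe.map principal (parent u))

  forbidden-child : ∀ {u w} → parent u ≡ just w → forbidden u ≡ principal w
  forbidden-child found = cong (fromMaybe _ ∘ Data.Maybe.map principal) found

  hue : V → Bool → C
  hue u = avoid u (forbidden u)

  hue-distinct : ∀ u → hue u true ≢ hue u false
  hue-distinct u = proj₁ (proj₂ (pair-avoiding _≟ᶜ_ (proj₁ (L u)) (proj₂ (L u)) (forbidden u))) ∘ proj₂ (L u)

  hue-avoids : ∀ u b → hue u b ≢ forbidden u
  hue-avoids u = proj₂ (proj₂ (pair-avoiding _≟ᶜ_ (proj₁ (L u)) (proj₂ (L u)) (forbidden u)))

  shade : V → Bool → C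
  shade u b with lem {FiniteDegree G u}
  ... | yes _ = hue u b
  ... | no _  = hue u true

  shade-is-hue : ∀ u b → ∃ λ b′ → shade u b ≡ hue u b′
  shade-is-hue u b with lem {FiniteDegree G u}
  ... | yes _ = b , refl
  ... | no _  = true , refl

  shade-flip : ∀ {u} b → FiniteDegree G u → shade u (not b) ≢ shade u b
  shade-flip {u} b finite with lem {FiniteDegree G u}
  ... | no infinite = contradiction finite infinite
  ... | yes _ with b
  ...   | true  = hue-distinct u ∘ sym
  ...   | false = hue-distinct u

  shade-infinite : ∀ {u} b → ¬ FiniteDegree G u → shade u b ≡ principal u
  shade-infinite {u} b infinite with lem {FiniteDegree G u}
  ... | yes finite = contradiction finite infinite
  ... | no _       = sym (principal-unfold u)

  shade-avoids-parent : ∀ {u w} b → parent u ≡ just w → shade u b ≢ principal w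
  shade-avoids-parent {u} b found eq =
    let b′ , shade≡hue = shade-is-hue u b
    in hue-avoids u b′ (trans (sym shade≡hue) (trans eq (sym (forbidden-child found))))

  colouring : (ℕ → Bool) → V → C
  colouring b u = shade u (b (e u))

  neighbours : V → List V
  neighbours v with lem {FiniteDegree G v}
  ... | yes (ns , _) = ns
  ... | no _         = []

  neighbours-enumerate : ∀ {v} → FiniteDegree G v → EnumeratesNbhd G v (neighbours v)
  neighbours-enumerate {v} finite with lem {FiniteDegree G v}
  ... | yes (_ , enumerates) = enumerates
  ... | no infinite          = contradiction finite infinite

  neighbours-adjacent : ∀ {v u} → FiniteDegree G v → (Adj v u ⇔ u ∈ neighbours v)
  neighbours-adjacent finite = proj₂ (neighbours-enumerate finite) _

  MajorityBelow : ℕ → (ℕ → Bool) → Set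
  MajorityBelow m b = ∀ v → e v < m → FiniteDegree G v → AtMostHalfMonochromatic (colouring b) v

  majority-below-exists : ∀ m → ∃ (MajorityBelow m)
  majority-below-exists m with enumerate-below (FiniteDegree G) m
  ... | S , S! , S≈ = b , λ v ev<m finite →
    at-most-half-local (recolour v) (λ {u} _ → recolour u)
      (at-most-half (neighbours-enumerate finite) (shade-flip (β v) finite)
                    (All.lookup optimum (Equivalence.to S≈ (finite , ev<m))))
    where
    finite : ∀ {v} → v ∈ S → FiniteDegree G v
    finite = proj₁ ∘ Equivalence.from S≈
    open LocalOptimum _≟_ _≟ᶜ_ neighbours shade S!
      (λ v∈S → proj₁ (neighbours-enumerate (finite v∈S)))
      (λ v∈S v∈N → irrefl (Equivalence.from (neighbours-adjacent (finite v∈S)) v∈N))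
      (λ u∈S v∈S u∈N → Equivalence.to (neighbours-adjacent (finite u∈S))
                          (Adj-sym (Equivalence.from (neighbours-adjacent (finite v∈S)) u∈N)))
    β = proj₁ locally-optimal-exists
    optimum = proj₂ locally-optimal-exists
    b = proj₁ (factor true β)
    recolour : ∀ u → colour β u ≡ colouring b u
    recolour u = cong (shade u) (sym (proj₂ (factor true β) u))

  open WeakKőnig lem MajorityBelow (λ m≤m′ majority v ev<m → majority v (<-≤-trans ev<m m≤m′)) majority-below-exists

  χ : V → C
  χ = colouring limit

  χ-finite : ∀ {v} → FiniteDegree G v → AtMostHalfMonochromatic χ v
  χ-finite {v} finite =
    let n , below = bound (v ∷ neighbours v)
        b , majority , b≈limit = limit-approximable n (suc (e v))
        agree : ∀ {u} → u ∈ v ∷ neighbours v → colouring b u ≡ χ u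
        agree u∈ = cong (shade _) (b≈limit _ (below u∈))
    in at-most-half-local {colouring b} {χ} {v} (agree (here refl)) (λ a → agree (there (Equivalence.to (neighbours-adjacent finite) a)))
                          (majority v ≤-refl finite)

  χ-infinite : ∀ {w} → ¬ FiniteDegree G w → ∀ xs → ∃ λ u → Adj w u × χ u ≢ χ w × u ∉ xs
  χ-infinite {w} infinite xs =
    let u , child , u∉xs = unbounded-escapes (children-unbounded candidates) xs
        (_ , a) , _ = parent-spec child
    in u , a , (λ χu≡χw → shade-avoids-parent _ child (trans χu≡χw (shade-infinite _ infinite))) , u∉xs
    where
    candidates : ∀ B → ∃ λ u → (¬ FiniteDegree G w × Adj w u) × B < e u
    candidates B = let u , a , B<eu = infinite-degree-unbounded infinite B in u , (infinite , a) , B<eu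

  χ-from-lists : FromLists L χ
  χ-from-lists u = let b′ , shade≡hue = shade-is-hue u (limit (e u)) in _ , sym shade≡hue

theorem5 : ExcludedMiddle 0ℓ →
    ∀ (V : Set) (G : Graph V) → Countable V → MajorityChoosable G 3
theorem5 lem V G (e , e-inj) C L =
  χ , (λ v → (λ ns enumerates → χ-finite (ns , enumerates) ns enumerates) , χ-infinite) , χ-from-lists
  where open MajorityColouring lem G e e-inj L
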